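{- Let $G$ be a saturated graph with $mp(G)=k$. Let $H$ be the graph obtained from $G$ by adding a new vertex $v$ adjacent to all vertices of $G$. Then $mp(H)=k+1$, and $H$ is saturated.
   Context: All graphs are finite and simple. A degree monotone path in a graph $G$ is a path $v_1v_2\ldots v_m$ such that $\deg(v_1)\le\cdots\le\deg(v_m)$ or $\deg(v_1)\ge\cdots\ge\deg(v_m)$, where degrees are taken in $G$. Its length is its number of vertices $m$. $mp(G)$ denotes the maximum length of a degree monotone path in $G$. A graph $G$ is called saturated if $mp(G+e) > mp(G)$ for every edge $e$ joining two nonadjacent vertices of $G$, where $G+e$ is $G$ with $e$ added. This holds vacuously for complete graphs. -}

module Defs where

open import Data.Nat using (ℕ; zero; suc; _≤_; _≥_; _<_)
open import Data.Fin using (Fin; zero; suc; _≟_)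
open import Data.Bool using (Bool; true; false; if_then_else_; _∨_; _∧_; T)
open import Data.List using (List; []; _∷_; length; map; allFin)
open import Data.Nat.ListAction using (sum)
open import Data.Empty using (⊥)
open import Data.List.Relation.Unary.Linked using (Linked)
open import Data.List.Relation.Unary.AllPairs using (AllPairs)
open import Data.Product using (Σ; _×_; _,_)
open import Data.Sum using (_⊎_)
open import Relation.Nullary using (¬_)
open import Relation.Nullary.Decidable using (⌊_⌋)
open import Relation.Binary.PropositionalEquality using (_≡_; _≢_)

Adj : ℕ → Set
Adj n = Fin n → Fin n → Bool

IsSimple : ∀ {n} → Adj n → Set
IsSimple {n} A = (∀ i j → A i j ≡ A j i) × (∀ i → A i i ≡ false)

deg : ∀ {n} → Adj n → Fin n → ℕ
deg {n} A i = sum (map (λ j → if A i j then 1 else 0) (allFin n))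

IsPath : ∀ {n} → Adj n → List (Fin n) → Set
IsPath A [] = ⊥
IsPath A (x ∷ xs) = AllPairs _≢_ (x ∷ xs) × Linked (λ u v → T (A u v)) (x ∷ xs)

IsDegMonotone : ∀ {n} → Adj n → List (Fin n) → Set
IsDegMonotone A p = Linked _≤_ (map (deg A) p) ⊎ Linked _≥_ (map (deg A) p)

IsDMPath : ∀ {n} → Adj n → List (Fin n) → Set
IsDMPath A p = IsPath A p × IsDegMonotone A p

MP : ∀ {n} → Adj n → ℕ → Set
MP {n} A k =
  Σ (List (Fin n)) (λ p → IsDMPath A p × length p ≡ k)
  × (∀ (p : List (Fin n)) → IsDMPath A p → length p ≤ k)

addEdge : ∀ {n} → Adj n → Fin n → Fin n → Adj n
addEdge A u v i j =
  A i j ∨ (⌊ i ≟ u ⌋ ∧ ⌊ j ≟ v ⌋) ∨ (⌊ i ≟ v ⌋ ∧ ⌊ j ≟ u ⌋)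

Saturated : ∀ {n} → Adj n → Set
Saturated {n} A =
  ∀ (u v : Fin n) → u ≢ v → A u v ≡ false →
  ∀ (k k' : ℕ) → MP A k → MP (addEdge A u v) k' → k < k'

cone : ∀ {n} → Adj n → Adj (suc n)
cone A zero    zero    = false
cone A zero    (suc j) = true
cone A (suc i) zero    = true
cone A (suc i) (suc j) = A i j

module Submission where

open import Defs
open import Data.Nat using (ℕ; suc)
open import Data.Product using (_×_)

-- The apex has degree n in H and every old vertex x
-- has degree deg_A(x) + 1 ≤ n, so degrees in H are those of A shifted by one
-- with the apex on top.  Hence
--   * extending: a non-decreasing path of A can be followed by the apex and
--     a non-increasing one preceded by it, giving a degree monotone path of H
--     with one more vertex;
--   * shortening: deleting the apex from a degree monotone path of H loses
--     one vertex.  If the apex was interior, between x and y, then one of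
--     x, y has degree n in H, i.e. degree n - 1 in A, so it is adjacent to
--     the other and the degree order between them survives in A.  Since adding an
-- edge between two old vertices of a cone gives the cone over A plus that
-- edge, saturation of A transfers to H by applying this to A + e.

open import Function using (_∘_; id)
open import Data.Nat using (_+_; _≤_; _<_; _≥_; z≤n; s≤s; s≤s⁻¹)
open import Data.Nat.Properties
  using (≤-refl; ≤-reflexive; ≤-trans; ≤-antisym; +-mono-≤; +-comm; <-irrefl; <-≤-trans; n<1+n; module ≤-Reasoning)
open import Data.Fin using (Fin; _≟_) renaming (zero to fzero; suc to fsuc)
open import Data.Fin.Properties using (suc-injective)
open import Data.Bool using (Bool; true; false; _∨_; _∧_; T; if_then_else_)
open import Data.Bool.Properties using (∨-comm; ∧-comm)
open import Data.Unit using (tt)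
open import Data.Empty using (⊥-elim)
open import Data.List using (List; []; _∷_; _∷ʳ_; length; map; allFin)
open import Data.List.Properties using (map-tabulate; map-cong; length-map; length-++)
open import Data.Nat.ListAction using (sum)
open import Data.List.Relation.Unary.All using (All; []; _∷_)
import Data.List.Relation.Unary.All as All
import Data.List.Relation.Unary.All.Properties as AllP
open import Data.List.Relation.Unary.AllPairs using (AllPairs; []; _∷_)
import Data.List.Relation.Unary.AllPairs as AllPairs
import Data.List.Relation.Unary.AllPairs.Properties as AllPairsP
open import Data.List.Relation.Unary.Linked using (Linked; []; [-]; _∷_)
import Data.List.Relation.Unary.Linked as Linked
import Data.List.Relation.Unary.Linked.Properties as LinkedP
open import Data.Product using (Σ; _,_; proj₁; proj₂)
open import Data.Sum using (_⊎_; inj₁; inj₂)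
open import Relation.Nullary using (yes; no)
open import Relation.Nullary.Decidable using (⌊_⌋)
open import Relation.Binary.PropositionalEquality

ind : Bool → ℕ
ind b = if b then 1 else 0

ind≤1 : ∀ b → ind b ≤ 1
ind≤1 true  = s≤s z≤n
ind≤1 false = z≤n

finSum : ∀ {n} → (Fin n → ℕ) → ℕ
finSum {n} f = sum (map f (allFin n))

finSum-suc : ∀ {n} (f : Fin (suc n) → ℕ) → finSum f ≡ f fzero + finSum (f ∘ fsuc)
finSum-suc f = cong (λ xs → f fzero + sum xs)
  (trans (map-tabulate fsuc f) (sym (map-tabulate id (f ∘ fsuc))))

finSum-cong : ∀ {n} {f g : Fin n → ℕ} → (∀ j → f j ≡ g j) → finSum f ≡ finSum g
finSum-cong {n} f≗g = cong sum (map-cong f≗g (allFin n))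

finSum-ones : ∀ n → finSum {n} (λ _ → 1) ≡ n
finSum-ones ℕ.zero = refl
finSum-ones (suc n) = trans (finSum-suc {n} (λ _ → 1)) (cong suc (finSum-ones n))

module _ where
  open ≤-Reasoning

  finSum-≤ : ∀ {n} (f : Fin n → ℕ) → (∀ j → f j ≤ 1) → finSum f ≤ n
  finSum-≤ {ℕ.zero} f f≤1 = z≤n
  finSum-≤ {suc n} f f≤1 = begin
    finSum f                     ≡⟨ finSum-suc f ⟩
    f fzero + finSum (f ∘ fsuc)  ≤⟨ +-mono-≤ (f≤1 fzero) (finSum-≤ (f ∘ fsuc) (f≤1 ∘ fsuc)) ⟩
    suc n                        ∎

  finSum-< : ∀ {n} (f : Fin n → ℕ) → (∀ j → f j ≤ 1) →
             ∀ i → f i ≡ 0 → finSum f < n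
  finSum-< {suc n} f f≤1 fzero fi≡0 = begin-strict
    finSum f                     ≡⟨ finSum-suc f ⟩
    f fzero + finSum (f ∘ fsuc)  ≡⟨ cong (_+ finSum (f ∘ fsuc)) fi≡0 ⟩
    finSum (f ∘ fsuc)            ≤⟨ finSum-≤ (f ∘ fsuc) (f≤1 ∘ fsuc) ⟩
    n                            <⟨ n<1+n n ⟩
    suc n                        ∎
  finSum-< {suc n} f f≤1 (fsuc i) fi≡0 = begin-strict
    finSum f                     ≡⟨ finSum-suc f ⟩
    f fzero + finSum (f ∘ fsuc)  ≤⟨ +-mono-≤ (f≤1 fzero) ≤-refl ⟩
    suc (finSum (f ∘ fsuc))      <⟨ s≤s (finSum-< (f ∘ fsuc) (f≤1 ∘ fsuc) i fi≡0) ⟩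
    suc n                        ∎

  finSum-<2 : ∀ {n} (f : Fin n → ℕ) → (∀ j → f j ≤ 1) →
              ∀ i j → i ≢ j → f i ≡ 0 → f j ≡ 0 → suc (finSum f) < n
  finSum-<2 f f≤1 fzero fzero i≢j _ _ = ⊥-elim (i≢j refl)
  finSum-<2 {suc n} f f≤1 fzero (fsuc j) _ fi≡0 fj≡0 = begin-strict
    suc (finSum f)                     ≡⟨ cong suc (finSum-suc f) ⟩
    suc (f fzero + finSum (f ∘ fsuc))  ≡⟨ cong (λ a → suc (a + finSum (f ∘ fsuc))) fi≡0 ⟩
    suc (finSum (f ∘ fsuc))            <⟨ s≤s (finSum-< (f ∘ fsuc) (f≤1 ∘ fsuc) j fj≡0) ⟩
    suc n                              ∎
  finSum-<2 {suc n} f f≤1 (fsuc i) fzero _ fi≡0 fj≡0 = begin-strict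
    suc (finSum f)                     ≡⟨ cong suc (finSum-suc f) ⟩
    suc (f fzero + finSum (f ∘ fsuc))  ≡⟨ cong (λ a → suc (a + finSum (f ∘ fsuc))) fj≡0 ⟩
    suc (finSum (f ∘ fsuc))            <⟨ s≤s (finSum-< (f ∘ fsuc) (f≤1 ∘ fsuc) i fi≡0) ⟩
    suc n                              ∎
  finSum-<2 {suc n} f f≤1 (fsuc i) (fsuc j) i≢j fi≡0 fj≡0 = begin-strict
    suc (finSum f)                     ≡⟨ cong suc (finSum-suc f) ⟩
    suc (f fzero + finSum (f ∘ fsuc))  ≤⟨ s≤s (+-mono-≤ (f≤1 fzero) ≤-refl) ⟩
    suc (suc (finSum (f ∘ fsuc)))      <⟨ s≤s (finSum-<2 (f ∘ fsuc) (f≤1 ∘ fsuc) i j (i≢j ∘ cong fsuc) fi≡0 fj≡0) ⟩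
    suc n                              ∎

deg<n : ∀ {n} (A : Adj n) {x} → A x x ≡ false → deg A x < n
deg<n A {x} loopless = finSum-< (ind ∘ A x) (ind≤1 ∘ A x) x (cong ind loopless)

full⇒adjacent : ∀ {n} (A : Adj n) {x y} → A x x ≡ false → x ≢ y →
                n ≤ suc (deg A x) → T (A x y)
full⇒adjacent A {x} {y} loopless x≢y full with A x y in nonadj
... | true  = tt
... | false = ⊥-elim (<-irrefl refl (<-≤-trans missing2 full))
  where
    missing2 : suc (deg A x) < _
    missing2 = finSum-<2 (ind ∘ A x) (ind≤1 ∘ A x) x y x≢y (cong ind loopless) (cong ind nonadj)

record IsCone {n} (H : Adj (suc n)) (A : Adj n) : Set where
  field
    apex-loopless : H fzero fzero ≡ false
    apex-adj      : ∀ j → H fzero (fsuc j) ≡ true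
    adj-apex      : ∀ i → H (fsuc i) fzero ≡ true
    base          : ∀ i j → H (fsuc i) (fsuc j) ≡ A i j

module ConeDegrees {n} {H : Adj (suc n)} {A : Adj n} (C : IsCone H A) where
  open IsCone C
  open ≡-Reasoning

  deg-apex : deg H fzero ≡ n
  deg-apex = begin
    deg H fzero                                     ≡⟨ finSum-suc (ind ∘ H fzero) ⟩
    ind (H fzero fzero) + finSum (ind ∘ H fzero ∘ fsuc)
      ≡⟨ cong₂ _+_ (cong ind apex-loopless) (finSum-cong (cong ind ∘ apex-adj)) ⟩
    finSum {n} (λ _ → 1)                            ≡⟨ finSum-ones n ⟩
    n                                               ∎

  deg-base : ∀ i → deg H (fsuc i) ≡ suc (deg A i)
  deg-base i = begin
    deg H (fsuc i)                                  ≡⟨ finSum-suc (ind ∘ H (fsuc i)) ⟩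
    ind (H (fsuc i) fzero) + finSum (ind ∘ H (fsuc i) ∘ fsuc)
      ≡⟨ cong₂ _+_ (cong ind (adj-apex i)) (finSum-cong (cong ind ∘ base i)) ⟩
    suc (deg A i)                                   ∎

Step : ∀ {n} → Adj n → (ℕ → ℕ → Set) → Fin n → Fin n → Set
Step A _≼_ u w = T (A u w) × deg A u ≼ deg A w

StepPath : ∀ {n} → Adj n → (ℕ → ℕ → Set) → List (Fin n) → Set
StepPath A _≼_ p = AllPairs _≢_ p × Linked (Step A _≼_) p

dm⇒steps : ∀ {n} {A : Adj n} {p} → IsDMPath A p → StepPath A _≤_ p ⊎ StepPath A _≥_ p
dm⇒steps {p = _ ∷ _} ((distinct , adjacent) , inj₁ up) =
  inj₁ (distinct , Linked.zip (adjacent , LinkedP.map⁻ up))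
dm⇒steps {p = _ ∷ _} ((distinct , adjacent) , inj₂ down) =
  inj₂ (distinct , Linked.zip (adjacent , LinkedP.map⁻ down))

steps⇒dm : ∀ {n} {A : Adj n} {_≼_ : ℕ → ℕ → Set} →
           (∀ {p} → Linked _≼_ (map (deg A) p) → IsDegMonotone A p) →
           ∀ {x xs} → StepPath A _≼_ (x ∷ xs) → IsDMPath A (x ∷ xs)
steps⇒dm orient (distinct , steps) =
  (distinct , proj₁ (Linked.unzip steps)) , orient (LinkedP.map⁺ (proj₂ (Linked.unzip steps)))

stepPath⇒dm : ∀ {n} {A : Adj n} {_≼_ : ℕ → ℕ → Set} → Fin n →
              (∀ {p} → Linked _≼_ (map (deg A) p) → IsDegMonotone A p) →
              ∀ p → StepPath A _≼_ p → Σ (List (Fin n)) (λ p' → IsDMPath A p' × length p ≤ length p')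
stepPath⇒dm w orient []       _  = w ∷ [] , ((([] ∷ []) , [-]) , inj₁ [-]) , z≤n
stepPath⇒dm w orient (x ∷ xs) sp = x ∷ xs , steps⇒dm orient sp , ≤-refl

linked-snoc-map : ∀ {B C : Set} {R' : B → B → Set} {R : C → C → Set} {f : B → C} {z : C} →
                  (∀ {x y} → R' x y → R (f x) (f y)) → (∀ x → R (f x) z) →
                  ∀ {xs} → Linked R' xs → Linked R (map f xs ∷ʳ z)
linked-snoc-map lift toZ []             = [-]
linked-snoc-map lift toZ {x ∷ []} [-]   = toZ x ∷ [-]
linked-snoc-map lift toZ (r ∷ rs)       = lift r ∷ linked-snoc-map lift toZ rs

linked-cons-map : ∀ {B C : Set} {R' : B → B → Set} {R : C → C → Set} {f : B → C} {z : C} →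
                  (∀ {x y} → R' x y → R (f x) (f y)) → (∀ x → R z (f x)) →
                  ∀ {xs} → Linked R' xs → Linked R (z ∷ map f xs)
linked-cons-map lift fromZ []         = [-]
linked-cons-map lift fromZ {x ∷ _} rs = fromZ x ∷ LinkedP.map⁺ (Linked.map lift rs)

distinct-lift : ∀ {n} {p : List (Fin n)} → AllPairs _≢_ p → AllPairs _≢_ (map fsuc p)
distinct-lift = AllPairsP.map⁺ ∘ AllPairs.map (λ x≢y → x≢y ∘ suc-injective)

apex∉lift : ∀ {n} (p : List (Fin n)) → All (fzero ≢_) (map fsuc p)
apex∉lift p = AllP.map⁺ (All.universal (λ _ ()) p)

distinct-snoc-apex : ∀ {n} {p : List (Fin n)} → AllPairs _≢_ p → AllPairs _≢_ (map fsuc p ∷ʳ fzero)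
distinct-snoc-apex {p = p} distinct =
  AllPairsP.++⁺ (distinct-lift distinct) ([] ∷ [])
    (All.map (λ apex≢x → (apex≢x ∘ sym) ∷ []) (apex∉lift p))

length-snoc-lift : ∀ {n} (p : List (Fin n)) → length (map fsuc p ∷ʳ fzero) ≡ suc (length p)
length-snoc-lift p = trans (length-++ (map fsuc p)) (trans (cong (_+ 1) (length-map fsuc p)) (+-comm _ 1))

dropApex : ∀ {n} → List (Fin (suc n)) → List (Fin n)
dropApex []            = []
dropApex (fzero ∷ xs)  = dropApex xs
dropApex (fsuc x ∷ xs) = x ∷ dropApex xs

all-dropApex : ∀ {n} {P : Fin (suc n) → Set} {q} → All P q → All (P ∘ fsuc) (dropApex q)
all-dropApex {q = []}         []       = []
all-dropApex {q = fzero ∷ _}  (_ ∷ ps) = all-dropApex ps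
all-dropApex {q = fsuc _ ∷ _} (p ∷ ps) = p ∷ all-dropApex ps

distinct-dropApex : ∀ {n} {q : List (Fin (suc n))} → AllPairs _≢_ q → AllPairs _≢_ (dropApex q)
distinct-dropApex {q = []}         []             = []
distinct-dropApex {q = fzero ∷ _}  (_ ∷ distinct) = distinct-dropApex distinct
distinct-dropApex {q = fsuc _ ∷ _} (x∉ ∷ distinct) =
  All.map (_∘ cong fsuc) (all-dropApex x∉) ∷ distinct-dropApex distinct

length-dropApex-apexFree : ∀ {n} {q : List (Fin (suc n))} → All (fzero ≢_) q →
                           length (dropApex q) ≡ length q
length-dropApex-apexFree {q = []}         []              = refl
length-dropApex-apexFree {q = fzero ∷ _}  (apex≢apex ∷ _) = ⊥-elim (apex≢apex refl)
length-dropApex-apexFree {q = fsuc _ ∷ _} (_ ∷ free)      = cong suc (length-dropApex-apexFree free)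

length-dropApex : ∀ {n} {q : List (Fin (suc n))} → AllPairs _≢_ q → length q ≤ suc (length (dropApex q))
length-dropApex {q = []}         []             = z≤n
length-dropApex {q = fzero ∷ _}  (free ∷ _)     = ≤-reflexive (cong suc (sym (length-dropApex-apexFree free)))
length-dropApex {q = fsuc _ ∷ _} (_ ∷ distinct) = s≤s (length-dropApex distinct)

linked-dropApex : ∀ {n} {R : Fin (suc n) → Fin (suc n) → Set} {R' : Fin n → Fin n → Set} →
                  (∀ {x y} → R (fsuc x) (fsuc y) → R' x y) →
                  (∀ {x y} → x ≢ y → R (fsuc x) fzero → R fzero (fsuc y) → R' x y) →
                  ∀ {q} → AllPairs _≢_ q → Linked R q → Linked R' (dropApex q)
linked-dropApex lower detour {[]} [] [] = []
linked-dropApex lower detour {fzero ∷ []} _ [-] = []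
linked-dropApex lower detour {fsuc x ∷ []} _ [-] = [-]
linked-dropApex lower detour {fzero ∷ _ ∷ _} (_ ∷ distinct) (_ ∷ steps) =
  linked-dropApex lower detour distinct steps
linked-dropApex lower detour {fsuc x ∷ fsuc y ∷ _} (_ ∷ distinct) (r ∷ steps) =
  lower r ∷ linked-dropApex lower detour distinct steps
linked-dropApex lower detour {fsuc x ∷ fzero ∷ []} _ (_ ∷ [-]) = [-]
linked-dropApex lower detour {fsuc x ∷ fzero ∷ fzero ∷ _} (_ ∷ ((apex≢apex ∷ _) ∷ _)) _ =
  ⊥-elim (apex≢apex refl)
linked-dropApex lower detour {fsuc x ∷ fzero ∷ fsuc y ∷ _}
  ((_ ∷ x≢y ∷ _) ∷ (_ ∷ distinct)) (r₁ ∷ r₂ ∷ steps) =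
  detour (x≢y ∘ cong fsuc) r₁ r₂ ∷ linked-dropApex lower detour distinct steps

module ConePaths {n} {H : Adj (suc n)} {A : Adj n} (C : IsCone H A) (simple : IsSimple A) where
  open IsCone C
  open ConeDegrees C

  private
    symmetric : ∀ i j → A i j ≡ A j i
    symmetric = proj₁ simple
    loopless : ∀ i → A i i ≡ false
    loopless = proj₂ simple

  -- A step between old vertices is the same step in H and in A, since both
  -- degrees are shifted by one.
  lift-step : ∀ {_≼_ : ℕ → ℕ → Set} → (∀ {a b} → a ≼ b → suc a ≼ suc b) →
              ∀ {x y} → Step A _≼_ x y → Step H _≼_ (fsuc x) (fsuc y)
  lift-step {_≼_} mono {x} {y} (xy , x≼y) =
    subst T (sym (base x y)) xy , subst₂ _≼_ (sym (deg-base x)) (sym (deg-base y)) (mono x≼y)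

  lower-step : ∀ {_≼_ : ℕ → ℕ → Set} → (∀ {a b} → suc a ≼ suc b → a ≼ b) →
               ∀ {x y} → Step H _≼_ (fsuc x) (fsuc y) → Step A _≼_ x y
  lower-step {_≼_} cancel {x} {y} (xy , x≼y) =
    subst T (base x y) xy , cancel (subst₂ _≼_ (deg-base x) (deg-base y) x≼y)

  base≤apex : ∀ x → deg H (fsuc x) ≤ deg H fzero
  base≤apex x = subst₂ _≤_ (sym (deg-base x)) (sym deg-apex) (deg<n A (loopless x))

  full : ∀ {x} → deg H fzero ≤ deg H (fsuc x) → n ≤ suc (deg A x)
  full {x} = subst₂ _≤_ deg-apex (deg-base x)

  detour-up : ∀ {x y} → x ≢ y → Step H _≤_ (fsuc x) fzero → Step H _≤_ fzero (fsuc y) → Step A _≤_ x y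
  detour-up {x} {y} x≢y _ (_ , apex≤y) =
    subst T (symmetric y x) (full⇒adjacent A (loopless y) (x≢y ∘ sym) (full apex≤y)) ,
    s≤s⁻¹ (≤-trans (deg<n A (loopless x)) (full apex≤y))

  detour-down : ∀ {x y} → x ≢ y → Step H _≥_ (fsuc x) fzero → Step H _≥_ fzero (fsuc y) → Step A _≥_ x y
  detour-down {x} {y} x≢y (_ , apex≤x) _ =
    full⇒adjacent A (loopless x) x≢y (full apex≤x) ,
    s≤s⁻¹ (≤-trans (deg<n A (loopless y)) (full apex≤x))

  extendPath : ∀ p → IsDMPath A p → Σ (List (Fin (suc n))) (λ q → IsDMPath H q × length q ≡ suc (length p))
  extendPath [] (() , _)
  extendPath (x ∷ xs) dm with dm⇒steps dm
  ... | inj₁ (distinct , steps) =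
    map fsuc (x ∷ xs) ∷ʳ fzero ,
    steps⇒dm inj₁ (distinct-snoc-apex distinct ,
                   linked-snoc-map (lift-step {_≤_} s≤s) (λ y → subst T (sym (adj-apex y)) tt , base≤apex y) steps) ,
    length-snoc-lift (x ∷ xs)
  ... | inj₂ (distinct , steps) =
    fzero ∷ map fsuc (x ∷ xs) ,
    steps⇒dm inj₂ (apex∉lift (x ∷ xs) ∷ distinct-lift distinct ,
                   linked-cons-map (lift-step {_≥_} s≤s) (λ y → subst T (sym (apex-adj y)) tt , base≤apex y) steps) ,
    cong suc (length-map fsuc (x ∷ xs))

  shortenStepPath : ∀ {_≼_ : ℕ → ℕ → Set} → Fin n →
                    (∀ {p} → Linked _≼_ (map (deg A) p) → IsDegMonotone A p) →
                    (∀ {q} → AllPairs _≢_ q → Linked (Step H _≼_) q → Linked (Step A _≼_) (dropApex q)) →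
                    ∀ q → StepPath H _≼_ q → Σ (List (Fin n)) (λ p → IsDMPath A p × length q ≤ suc (length p))
  shortenStepPath w orient drop q (distinct , steps)
    with stepPath⇒dm w orient (dropApex q) (distinct-dropApex distinct , drop distinct steps)
  ... | p , dmp , longer = p , dmp , ≤-trans (length-dropApex distinct) (s≤s longer)

  shortenPath : Fin n → ∀ q → IsDMPath H q → Σ (List (Fin n)) (λ p → IsDMPath A p × length q ≤ suc (length p))
  shortenPath w q dm with dm⇒steps dm
  ... | inj₁ up   = shortenStepPath w inj₁ (linked-dropApex (lower-step {_≤_} s≤s⁻¹) detour-up) q up
  ... | inj₂ down = shortenStepPath w inj₂ (linked-dropApex (lower-step {_≥_} s≤s⁻¹) detour-down) q down

MP-unique : ∀ {n} {A : Adj n} {k k'} → MP A k → MP A k' → k ≡ k'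
MP-unique ((p , dm , refl) , maximal) ((p' , dm' , refl) , maximal') =
  ≤-antisym (maximal' p dm) (maximal p' dm')

module MPTransfer {n m} {A : Adj n} {B : Adj m}
  (extend : ∀ p → IsDMPath A p → Σ (List (Fin m)) (λ q → IsDMPath B q × length q ≡ suc (length p)))
  (shrink : ∀ q → IsDMPath B q → Σ (List (Fin n)) (λ p → IsDMPath A p × length q ≤ suc (length p)))
  where

  extension-bound : ∀ {k} → MP B k → ∀ p → IsDMPath A p → suc (length p) ≤ k
  extension-bound (_ , maximal) p dm with extend p dm
  ... | q , dmq , longer = subst (_≤ _) longer (maximal q dmq)

  mp-suc : ∀ {k} → MP A k → MP B (suc k)
  mp-suc ((p , dm , refl) , maximal) with extend p dm
  ... | q , dmq , longer = (q , dmq , longer) , bound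
    where
      bound : ∀ q' → IsDMPath B q' → length q' ≤ suc (length p)
      bound q' dmq' with shrink q' dmq'
      ... | p' , dmp' , shorter = ≤-trans shorter (s≤s (maximal p' dmp'))

  mp-pred : ∀ {k} → MP B k → Σ ℕ (λ j → k ≡ suc j × MP A j)
  mp-pred mpB@((q , dmq , refl) , _) with shrink q dmq
  ... | p , dmp , shorter =
    length p , ≤-antisym shorter (extension-bound mpB p dmp) , (p , dmp , refl) ,
    λ p' dmp' → s≤s⁻¹ (≤-trans (extension-bound mpB p' dmp') shorter)

cone-mp : ∀ {n} {H : Adj (suc n)} {A : Adj n} {k} → IsCone H A → IsSimple A → MP A k → MP H (suc k)
cone-mp C simple (([] , (() , _) , _) , _)
cone-mp C simple mpA@(((x ∷ _) , _) , _) = MPTransfer.mp-suc extendPath (shortenPath x) mpA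
  where open ConePaths C simple

cone-mp⁻ : ∀ {n} {H : Adj (suc n)} {A : Adj n} {k} → IsCone H A → IsSimple A → Fin n →
           MP H k → Σ ℕ (λ j → k ≡ suc j × MP A j)
cone-mp⁻ C simple x = MPTransfer.mp-pred extendPath (shortenPath x)
  where open ConePaths C simple

cone-isCone : ∀ {n} (G : Adj n) → IsCone (cone G) G
cone-isCone G = record
  { apex-loopless = refl ; apex-adj = λ _ → refl ; adj-apex = λ _ → refl ; base = λ _ _ → refl }

⌊fsuc≟fsuc⌋ : ∀ {n} (i j : Fin n) → ⌊ fsuc i ≟ fsuc j ⌋ ≡ ⌊ i ≟ j ⌋
⌊fsuc≟fsuc⌋ i j with i ≟ j
... | yes _ = refl
... | no _  = refl

addEdge-cone : ∀ {n} (G : Adj n) u v → IsCone (addEdge (cone G) (fsuc u) (fsuc v)) (addEdge G u v)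
addEdge-cone G u v = record
  { apex-loopless = refl ; apex-adj = λ _ → refl ; adj-apex = λ _ → refl ; base = base }
  where
    base : ∀ i j → addEdge (cone G) (fsuc u) (fsuc v) (fsuc i) (fsuc j) ≡ addEdge G u v i j
    base i j rewrite ⌊fsuc≟fsuc⌋ i u | ⌊fsuc≟fsuc⌋ j v | ⌊fsuc≟fsuc⌋ i v | ⌊fsuc≟fsuc⌋ j u = refl

addEdge-simple : ∀ {n} (G : Adj n) u v → u ≢ v → IsSimple G → IsSimple (addEdge G u v)
addEdge-simple G u v u≢v (symmetric , loopless) = symmetric' , loopless'
  where
    symmetric' : ∀ i j → addEdge G u v i j ≡ addEdge G u v j i
    symmetric' i j = cong₂ _∨_ (symmetric i j)
      (trans (∨-comm (⌊ i ≟ u ⌋ ∧ ⌊ j ≟ v ⌋) (⌊ i ≟ v ⌋ ∧ ⌊ j ≟ u ⌋))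
             (cong₂ _∨_ (∧-comm ⌊ i ≟ v ⌋ ⌊ j ≟ u ⌋) (∧-comm ⌊ i ≟ u ⌋ ⌊ j ≟ v ⌋)))
    loopless' : ∀ i → addEdge G u v i i ≡ false
    loopless' i rewrite loopless i with i ≟ u | i ≟ v
    ... | yes refl | yes refl = ⊥-elim (u≢v refl)
    ... | yes _    | no _     = refl
    ... | no _     | yes _    = refl
    ... | no _     | no _     = refl

-- The cone over a saturated simple graph is saturated: the apex is already
-- adjacent to everything, and a missing edge between old vertices raises
-- mp of the base, hence of the cone.
cone-saturated : ∀ {n} (G : Adj n) {k} → IsSimple G → Saturated G → MP G k → Saturated (cone G)
cone-saturated G simple saturated mpG fzero fzero apex≢apex _ = ⊥-elim (apex≢apex refl)
cone-saturated G simple saturated mpG fzero (fsuc v) _ ()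
cone-saturated G simple saturated mpG (fsuc u) fzero _ ()
cone-saturated G {k} simple saturated mpG (fsuc u) (fsuc v) u≢v nonadjacent k₁ k' mpH mpH+e
  with cone-mp⁻ (addEdge-cone G u v) (addEdge-simple G u v (u≢v ∘ cong fsuc) simple) u mpH+e
... | j , refl , mpG+e = begin-strict
  k₁     ≡⟨ MP-unique mpH (cone-mp (cone-isCone G) simple mpG) ⟩
  suc k  <⟨ s≤s (saturated u v (u≢v ∘ cong fsuc) nonadjacent k j mpG mpG+e) ⟩
  suc j  ∎
  where open ≤-Reasoning

lemma2p6 : ∀ (n : ℕ) (G : Adj n) (k : ℕ) →
    IsSimple G → Saturated G → MP G k →
    MP (cone G) (suc k) × Saturated (cone G)
lemma2p6 n G k simple saturated mpG =
  cone-mp (cone-isCone G) simple mpG , cone-saturated G simple saturated mpG
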